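{- Let $G_T=(V_T,E_T)$, $G_W=(V_W,E_W)$ be graphs with candidate sets $C[t]\subseteq V_W$ for $t\in V_T$, and let $G_C$ be the associated candidate structure. Suppose $u\in V_T$, $c_1,c_2\in C[u]$, $c_1\sim_{c,u}c_2$, and neither $c_1$ nor $c_2$ belongs to $C[t]$ for any $t\in V_T\setminus\{u\}$. Then $c_1$ and $c_2$ are $G_C$-interchangeable.
   Context: A graph is a pair $G=(V,E)$ with $V$ finite and $E\subseteq V\times V$ (directed edges), with no self-loops. A subgraph isomorphism from $G_T$ to $G_W$ is an injective $f:V_T\to V_W$ with $(t_1,t_2)\in E_T\Rightarrow(f(t_1),f(t_2))\in E_W$. Two vertices $x,y$ of a directed graph $(V,E)$ are structurally equivalent ($x\sim_s y$) if for all $z\in V\setminus\{x,y\}$: $(z,x)\in E\Leftrightarrow(z,y)\in E$ and $(x,z)\in E\Leftrightarrow(y,z)\in E$, and moreover $(x,y)\in E\Leftrightarrow(y,x)\in E$. Given candidate sets $C[t]\subseteq V_W$ ($t\in V_T$), the candidate structure is the directed graph $G_C=(V_C,E_C)$ with $V_C=\{(t,c):t\in V_T,\ c\in C[t]\}$ and $((t_1,c_1),(t_2,c_2))\in E_C$ iff $(t_1,t_2)\in E_T$ and $(c_1,c_2)\in E_W$. For $u\in V_T$ and $c_1,c_2\in V_W$, $c_1\sim_{c,u}c_2$ (candidate equivalence with respect to $u$) means: either $c_1,c_2\notin C[u]$, or $c_1,c_2\in C[u]$ and $(u,c_1)\sim_s(u,c_2)$ in $G_C$. A subgraph isomorphism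 $f$ is derived from $G_C$ if $f(t)\in C[t]$ for all $t\in V_T$. World vertices $w_1,w_2$ are $G_C$-interchangeable if for every subgraph isomorphism $f$ derived from $G_C$: if both lie in the image of $f$, say $f(v)=w_1$, $f(w)=w_2$, then the map obtained from $f$ by setting $v\mapsto w_2$, $w\mapsto w_1$ is a subgraph isomorphism; and if only one of them lies in the image, say $f(v)=w_1$ (resp. $f(v)=w_2$), then the map obtained from $f$ by setting $v\mapsto w_2$ (resp. $v\mapsto w_1$) is a subgraph isomorphism. -}

module Defs where

open import Data.Nat using (ℕ)
open import Data.Fin using (Fin; _≟_)
open import Data.Fin.Subset using (Subset; _∈_; _∉_)
open import Data.Product using (Σ; _×_; _,_)
open import Data.Sum using (_⊎_)
open import Data.Bool using (if_then_else_)
open import Relation.Nullary using (¬_)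
open import Relation.Nullary.Decidable using (⌊_⌋)
open import Relation.Binary.PropositionalEquality using (_≡_; _≢_)
open import Function using (Injective)
open import Function.Bundles using (_⇔_)

record Graph : Set₁ where
  field
    n     : ℕ
    E     : Fin n → Fin n → Set
    noLoop : ∀ v → ¬ E v v

open Graph public

StructEquiv : (V : Set) (E : V → V → Set) → V → V → Set
StructEquiv V E x y =
  (∀ z → z ≢ x → z ≢ y → (E z x ⇔ E z y) × (E x z ⇔ E y z)) × (E x y ⇔ E y x)

Candidates : Graph → Graph → Set
Candidates GT GW = Fin (n GT) → Subset (n GW)

module _ (GT GW : Graph) (C : Candidates GT GW) where

  VC : Set
  VC = Σ (Fin (n GT) × Fin (n GW)) (λ { (t , c) → c ∈ C t })

  EC : VC → VC → Set
  EC ((t₁ , c₁) , _) ((t₂ , c₂) , _) = E GT t₁ t₂ × E GW c₁ c₂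

  CandEquiv : Fin (n GT) → Fin (n GW) → Fin (n GW) → Set
  CandEquiv u c₁ c₂ =
    (c₁ ∉ C u × c₂ ∉ C u)
    ⊎ Σ (c₁ ∈ C u) (λ p → Σ (c₂ ∈ C u) (λ q →
        StructEquiv VC EC ((u , c₁) , p) ((u , c₂) , q)))

  IsSubIso : (Fin (n GT) → Fin (n GW)) → Set
  IsSubIso f = Injective _≡_ _≡_ f
             × (∀ t₁ t₂ → E GT t₁ t₂ → E GW (f t₁) (f t₂))

  Derived : (Fin (n GT) → Fin (n GW)) → Set
  Derived f = ∀ t → f t ∈ C t

  update : (Fin (n GT) → Fin (n GW)) → Fin (n GT) → Fin (n GW)
         → Fin (n GT) → Fin (n GW)
  update f v a x = if ⌊ x ≟ v ⌋ then a else f x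

  Interchangeable : Fin (n GW) → Fin (n GW) → Set
  Interchangeable w₁ w₂ =
    ∀ f → IsSubIso f → Derived f →
      (∀ v w → f v ≡ w₁ → f w ≡ w₂ →
         IsSubIso (update (update f v w₂) w w₁))
    × (∀ v → f v ≡ w₁ → (∀ x → f x ≢ w₂) → IsSubIso (update f v w₂))
    × (∀ v → f v ≡ w₂ → (∀ x → f x ≢ w₁) → IsSubIso (update f v w₁))

module Submission where

open import Defs
open import Data.Fin using (Fin; _≟_)
open import Data.Fin.Subset using (_∈_; _∉_)
open import Data.Product using (_×_; _,_; proj₁; proj₂)
open import Data.Sum using (inj₁; inj₂)
open import Data.Empty using (⊥-elim)
open import Relation.Nullary using (yes; no)
open import Relation.Binary.PropositionalEquality
open import Function using (_∘′_)
open import Function.Bundles using (Equivalence; _⇔_)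
open import Function.Properties.Equivalence using () renaming (sym to ⇔-sym)

-- Since c₁ and c₂ are candidates of u alone, a derived isomorphism can only send u to
-- them. If both are hit, both equal f u and the swap changes nothing; if only one is hit,
-- the swap moves u from one to the other, and the structural equivalence of (u , c₁) and
-- (u , c₂) in G_C supplies the world edges the moved vertex needs, because every other
-- pattern vertex t is mapped into C[t].

StructEquiv-sym : ∀ {V : Set} {E : V → V → Set} {x y : V} →
                  StructEquiv V E x y → StructEquiv V E y x
StructEquiv-sym {E = E} {x} {y} (neighbours , between) = flipped , ⇔-sym between
  where
  flipped : ∀ z → z ≢ y → z ≢ x → (E z y ⇔ E z x) × (E y z ⇔ E x z)
  flipped z z≢y z≢x with neighbours z z≢x z≢y
  ... | into , outof = ⇔-sym into , ⇔-sym outof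

module _ (GT GW : Graph) (C : Candidates GT GW) where

  private
    V : Set
    V = Fin (n GT)

    W : Set
    W = Fin (n GW)

    _[_↦_] : (V → W) → V → W → V → W
    f [ v ↦ a ] = update GT GW C f v a

  update-restore : ∀ f v a → (f [ v ↦ a ]) [ v ↦ f v ] ≗ f
  update-restore f v a x with x ≟ v
  ... | yes refl = refl
  ... | no _     = refl

  IsSubIso-resp-≗ : ∀ {f g} → f ≗ g → IsSubIso GT GW C f → IsSubIso GT GW C g
  IsSubIso-resp-≗ f≗g (injective , edges) =
    (λ {x} {y} gx≡gy → injective (trans (f≗g x) (trans gx≡gy (sym (f≗g y)))))
    , λ t₁ t₂ e → subst₂ (E GW) (f≗g t₁) (f≗g t₂) (edges t₁ t₂ e)

  CoversEdges : (V → W) → V → W → W → Set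
  CoversEdges f u a b = ∀ t → t ≢ u →
      (E GT u t → E GW a (f t) → E GW b (f t))
    × (E GT t u → E GW (f t) a → E GW (f t) b)

  IsSubIso-relocate : ∀ {f u b} → IsSubIso GT GW C f → (∀ x → f x ≢ b) →
                      CoversEdges f u (f u) b → IsSubIso GT GW C (f [ u ↦ b ])
  IsSubIso-relocate {f} {u} {b} (injective , edges) b∉img covers = injective′ , edges′
    where
    injective′ : ∀ {x y} → (f [ u ↦ b ]) x ≡ (f [ u ↦ b ]) y → x ≡ y
    injective′ {x} {y} eq with x ≟ u | y ≟ u
    ... | yes x≡u | yes y≡u = trans x≡u (sym y≡u)
    ... | yes _   | no _    = ⊥-elim (b∉img y (sym eq))
    ... | no _    | yes _   = ⊥-elim (b∉img x eq)
    ... | no _    | no _    = injective eq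

    edges′ : ∀ t₁ t₂ → E GT t₁ t₂ → E GW ((f [ u ↦ b ]) t₁) ((f [ u ↦ b ]) t₂)
    edges′ t₁ t₂ e with t₁ ≟ u | t₂ ≟ u
    ... | yes refl | yes refl = ⊥-elim (noLoop GT t₁ e)
    ... | yes refl | no t₂≢u  = proj₁ (covers t₂ t₂≢u) e (edges t₁ t₂ e)
    ... | no t₁≢u  | yes refl = proj₂ (covers t₁ t₁≢u) e (edges t₁ t₂ e)
    ... | no _     | no _     = edges t₁ t₂ e

  derived-preimage : ∀ {f c u v} → Derived GT GW C f → (∀ t → t ≢ u → c ∉ C t) →
                     f v ≡ c → v ≡ u
  derived-preimage {u = u} {v} derived exclusive fv≡c with v ≟ u
  ... | yes v≡u = v≡u
  ... | no v≢u  = ⊥-elim (exclusive v v≢u (subst (_∈ C v) fv≡c (derived v)))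

  StructEquiv⇒CoversEdges :
    ∀ {f u a b} (a∈Cu : a ∈ C u) (b∈Cu : b ∈ C u) → Derived GT GW C f →
    StructEquiv (VC GT GW C) (EC GT GW C) ((u , a) , a∈Cu) ((u , b) , b∈Cu) →
    CoversEdges f u a b
  StructEquiv⇒CoversEdges {f} a∈Cu b∈Cu derived (neighbours , _) t t≢u
    with neighbours ((t , f t) , derived t) (t≢u ∘′ cong (proj₁ ∘′ proj₁))
                                            (t≢u ∘′ cong (proj₁ ∘′ proj₁))
  ... | into , outof =
      (λ e e′ → proj₂ (Equivalence.to outof (e , e′)))
    , (λ e e′ → proj₂ (Equivalence.to into (e , e′)))

  module _ {f : V → W} (iso : IsSubIso GT GW C f) (derived : Derived GT GW C f)
           {u : V} {a b : W} where

    IsSubIso-swap-exclusive : (∀ t → t ≢ u → a ∉ C t) → (∀ t → t ≢ u → b ∉ C t) →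
                              ∀ v w → f v ≡ a → f w ≡ b →
                              IsSubIso GT GW C ((f [ v ↦ b ]) [ w ↦ a ])
    IsSubIso-swap-exclusive a-exclusive b-exclusive v w fv≡a fw≡b
      with derived-preimage derived a-exclusive fv≡a
         | derived-preimage derived b-exclusive fw≡b
    ... | refl | refl rewrite sym fv≡a =
      IsSubIso-resp-≗ (λ x → sym (update-restore f v b x)) iso

    IsSubIso-move-exclusive :
      (a∈Cu : a ∈ C u) (b∈Cu : b ∈ C u) →
      StructEquiv (VC GT GW C) (EC GT GW C) ((u , a) , a∈Cu) ((u , b) , b∈Cu) →
      (∀ t → t ≢ u → a ∉ C t) →
      ∀ v → f v ≡ a → (∀ x → f x ≢ b) → IsSubIso GT GW C (f [ v ↦ b ])
    IsSubIso-move-exclusive a∈Cu b∈Cu equiv a-exclusive v fv≡a b∉img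
      with derived-preimage derived a-exclusive fv≡a
    ... | refl rewrite sym fv≡a =
      IsSubIso-relocate iso b∉img (StructEquiv⇒CoversEdges a∈Cu b∈Cu derived equiv)

proposition6 : (GT GW : Graph) (C : Candidates GT GW)
    (u : Fin (n GT)) (c₁ c₂ : Fin (n GW))
    → c₁ ∈ C u → c₂ ∈ C u
    → CandEquiv GT GW C u c₁ c₂
    → (∀ t → t ≢ u → c₁ ∉ C t)
    → (∀ t → t ≢ u → c₂ ∉ C t)
    → Interchangeable GT GW C c₁ c₂
proposition6 GT GW C u c₁ c₂ c₁∈Cu _ (inj₁ (c₁∉Cu , _)) _ _ = ⊥-elim (c₁∉Cu c₁∈Cu)
proposition6 GT GW C u c₁ c₂ _ _ (inj₂ (c₁∈Cu , c₂∈Cu , equiv)) c₁-exclusive c₂-exclusive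
             f iso derived =
    IsSubIso-swap-exclusive GT GW C iso derived c₁-exclusive c₂-exclusive
  , IsSubIso-move-exclusive GT GW C iso derived c₁∈Cu c₂∈Cu equiv c₁-exclusive
  , IsSubIso-move-exclusive GT GW C iso derived c₂∈Cu c₁∈Cu
      (StructEquiv-sym {E = EC GT GW C} equiv) c₂-exclusive
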